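{- Let $\mathcal P_d=(P,R,f)$ be a DPS instance such that (1) for every $e\in R$, $f_e$ is a power of two, and (2) for every $v\in P$, $\sum_{e\in R:\,v\in e}\frac1{f_e}\le\frac12$. Then there exists a valid schedule for $\mathcal P_d$.
   Context: A DPS instance $(P,R,f)$ consists of a finite simple undirected graph $(P,R)$ with integer frequencies $f:R\to\mathbb N$, $f_e=f(e)$. A schedule $S:\mathbb N_0\to2^R$ is valid if each $S(t)$ is a matching of $(P,R)$ and for every $e\in R$ the recurrence time $r_S(e)\le f_e$, where $r_S(e)$ is the supremum of $d+1$ over $d\in\mathbb N$ such that $e\notin S(t)\cup\dots\cup S(t+d-1)$ for some $t\in\mathbb N_0$ (and $1$ if there is no such $d$); i.e. every window of $f_e$ consecutive days contains a day on which $e$ is scheduled. -}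

module Defs where

open import Data.Nat using (ℕ; zero; suc; _+_; _^_; _<_)
open import Data.Fin using (Fin; toℕ)
open import Data.Bool using (Bool; true; false; if_then_else_)
open import Data.Product using (_×_; _,_; proj₁; proj₂; ∃-syntax)
open import Data.Integer using (+_)
open import Data.Rational using (ℚ; 0ℚ; _/_; _≤_) renaming (_+_ to _+ℚ_)
open import Relation.Binary.PropositionalEquality using (_≡_; _≢_)
open import Relation.Nullary using (¬_; does)
open import Data.Fin using (_≟_)

-- A finite simple undirected graph on vertex set P = Fin n with edge set
-- R = Fin m. Edge e joins endpoints (proj₁ (ends e)) and (proj₂ (ends e)),
-- normalised so that the first is strictly smaller (no loops, undirected),
-- and distinct edge indices give distinct endpoint pairs (no multi-edges).
record Graph : Set where
  field
    n    : ℕ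
    m    : ℕ
    ends : Fin m → Fin n × Fin n
    ordered  : ∀ e → toℕ (proj₁ (ends e)) < toℕ (proj₂ (ends e))
    injective : ∀ e e′ → ends e ≡ ends e′ → e ≡ e′

open Graph public

Vertex : Graph → Set
Vertex G = Fin (n G)

Edge : Graph → Set
Edge G = Fin (m G)

_∈ᵉ_ : {G : Graph} → Vertex G → Edge G → Set
_∈ᵉ_ {G} v e = (v ≡ proj₁ (ends G e)) Data.Sum.⊎ (v ≡ proj₂ (ends G e))
  where import Data.Sum

incident? : (G : Graph) → Vertex G → Edge G → Bool
incident? G v e with does (v ≟ proj₁ (ends G e)) | does (v ≟ proj₂ (ends G e))
... | false | false = false
... | _     | _     = true

-- reciprocal 1/x as a rational (0 ↦ 0; only used for x ≥ 1)
recip : ℕ → ℚ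
recip zero    = 0ℚ
recip (suc k) = (+ 1) / suc k

sumFin : (k : ℕ) → (Fin k → ℚ) → ℚ
sumFin zero    g = 0ℚ
sumFin (suc k) g = g Fin.zero +ℚ sumFin k (λ i → g (Fin.suc i))
  where import Data.Fin as Fin

load : (G : Graph) → (Edge G → ℕ) → Vertex G → ℚ
load G f v = sumFin (m G) (λ e → if incident? G v e then recip (f e) else 0ℚ)

IsPowerOfTwo : ℕ → Set
IsPowerOfTwo x = ∃[ k ] x ≡ 2 ^ k

-- a schedule: S t e ≡ true iff edge e ∈ S(t)
Schedule : Graph → Set
Schedule G = ℕ → Edge G → Bool

IsMatching : (G : Graph) → (Edge G → Bool) → Set
IsMatching G s = ∀ (e e′ : Edge G) → s e ≡ true → s e′ ≡ true → e ≢ e′ →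
                 ∀ (v : Vertex G) → _∈ᵉ_ {G} v e → ¬ (_∈ᵉ_ {G} v e′)

-- r_S(e) ≤ f_e : every window of f_e consecutive days t, …, t+f_e-1
-- contains a day on which e is scheduled
Valid : (G : Graph) → (f : Edge G → ℕ) → Schedule G → Set
Valid G f S = (∀ t → IsMatching G (S t)) ×
              (∀ e t → ∃[ i ] (i < f e × S (t + i) e ≡ true))

module Submission where

-- Write f e = 2 ^ k e and schedule e on the days t with t % f e ≡ ρ e, for an offset
-- ρ e < f e; every window of f e days contains such a day. When f e′ divides f e, the
-- progressions of e and e′ meet iff ρ e % f e′ ≡ ρ e′, so the offsets are chosen greedily in
-- order of increasing period. When e is reached, a neighbour e′ of smaller period at an
-- endpoint w occupies f e / f e′ residues modulo f e. By the load bound at w these numbers,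
-- together with the 1 contributed by e itself, add up to at most f e / 2, so the two
-- endpoints of e block at most f e − 2 residues and a free offset remains.

module Counting where

  open import Level using (Level)
  open import Data.Nat
  open import Data.Nat.Properties
  open import Data.Nat.DivMod using (_%_; m<n⇒m%n≡m; [m+n]%n≡m%n)
  open import Data.Fin using (Fin; zero; suc)
  open import Data.Fin.Properties using (any?)
  open import Data.Bool using (if_then_else_)
  open import Data.Product using (∃-syntax; _×_; _,_)
  open import Data.Sum using (_⊎_; inj₁; inj₂)
  open import Data.Vec.Functional using (Vector)
  open import Algebra.Properties.Monoid.Sum +-0-monoid using (sum)
  open import Function using (_∘_)
  open import Relation.Unary using (Pred; Decidable)
  open import Relation.Unary.Properties using (_∪?_)
  open import Relation.Nullary using (yes; no; does; ¬_; contradiction)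
  open import Relation.Binary.PropositionalEquality

  private variable
    ℓ : Level
    P Q : Pred ℕ ℓ

  count : Decidable P → ℕ → ℕ
  count P? zero    = 0
  count P? (suc n) = if does (P? n) then suc (count P? n) else count P? n

  module _ {P? : Decidable P} where

    count-none : ∀ n → (∀ {x} → x < n → ¬ P x) → count P? n ≡ 0
    count-none zero    _    = refl
    count-none (suc n) none with P? n
    ... | yes p = contradiction p (none ≤-refl)
    ... | no _  = count-none n (none ∘ m<n⇒m<1+n)

    count-unique : ∀ n → (∀ {x y} → x < n → y < n → P x → P y → x ≡ y) → count P? n ≤ 1
    count-unique zero    _      = z≤n
    count-unique (suc n) unique with P? n
    ... | yes p = s≤s (≤-reflexive (count-none n λ x<n px →
                    <-irrefl (unique (m<n⇒m<1+n x<n) ≤-refl px p) x<n))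
    ... | no _  = count-unique n λ x<n y<n → unique (m<n⇒m<1+n x<n) (m<n⇒m<1+n y<n)

    count-+ : ∀ m n → count P? (m + n) ≡ count P? m + count (P? ∘ (m +_)) n
    count-+ m zero = trans (cong (count P?) (+-identityʳ m)) (sym (+-identityʳ _))
    count-+ m (suc n) rewrite +-suc m n with P? (m + n)
    ... | yes _ = trans (cong suc (count-+ m n)) (sym (+-suc _ _))
    ... | no _  = count-+ m n

    count<⇒∃∉ : ∀ n → count P? n < n → ∃[ x ] x < n × ¬ P x
    count<⇒∃∉ (suc n) count< with P? n
    ... | no ¬p = n , ≤-refl , ¬p
    ... | yes _ with x , x<n , ¬px ← count<⇒∃∉ n (≤-pred count<) = x , m<n⇒m<1+n x<n , ¬px

    module _ {Q? : Decidable Q} where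

      count-mono : (∀ {x} → P x → Q x) → ∀ n → count P? n ≤ count Q? n
      count-mono P⊆Q zero = z≤n
      count-mono P⊆Q (suc n) with P? n | Q? n
      ... | yes p | no ¬q = contradiction (P⊆Q p) ¬q
      ... | yes _ | yes _ = s≤s (count-mono P⊆Q n)
      ... | no _  | yes _ = m≤n⇒m≤1+n (count-mono P⊆Q n)
      ... | no _  | no _  = count-mono P⊆Q n

      count-∪ : ∀ n → count (P? ∪? Q?) n ≤ count P? n + count Q? n
      count-∪ zero = z≤n
      count-∪ (suc n) with P? n | Q? n
      ... | yes _ | yes _ = s≤s (≤-trans (count-∪ n) (+-monoʳ-≤ _ (n≤1+n _)))
      ... | yes _ | no _  = s≤s (count-∪ n)
      ... | no _  | yes _ = ≤-trans (s≤s (count-∪ n)) (≤-reflexive (sym (+-suc _ _)))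
      ... | no _  | no _  = count-∪ n

  count-∃ : ∀ {m} {Q : Fin m → Pred ℕ ℓ} (Q? : ∀ i → Decidable (Q i)) n →
            count (λ x → any? (λ i → Q? i x)) n ≤ sum (λ i → count (Q? i) n)
  count-∃ {m = zero}  Q? n = ≤-reflexive (count-none n λ _ ())
  count-∃ {m = suc m} {Q = Q} Q? n = begin
    count (λ x → any? (λ i → Q? i x)) n                     ≤⟨ count-mono split n ⟩
    count (Q? zero ∪? (λ x → any? (λ i → Q? (suc i) x))) n  ≤⟨ count-∪ n ⟩
    count (Q? zero) n + count (λ x → any? (λ i → Q? (suc i) x)) n
                                                            ≤⟨ +-monoʳ-≤ _ (count-∃ (Q? ∘ suc) n) ⟩
    sum (λ i → count (Q? i) n)                              ∎
    where
    open ≤-Reasoning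
    split : ∀ {x} → ∃[ i ] Q i x → Q zero x ⊎ ∃[ i ] Q (suc i) x
    split (zero  , q) = inj₁ q
    split (suc i , q) = inj₂ (i , q)

  count-%≡ : ∀ q d a .{{_ : NonZero d}} → count (λ x → x % d ≟ a) (q * d) ≤ q
  count-%≡ zero    d a = z≤n
  count-%≡ (suc q) d a = begin
    count (λ x → x % d ≟ a) (d + q * d)   ≡⟨ count-+ d (q * d) ⟩
    count (λ x → x % d ≟ a) d + count (λ x → (d + x) % d ≟ a) (q * d)
                                          ≤⟨ +-mono-≤ (count-unique d residue-unique) (count-mono shift (q * d)) ⟩
    1 + count (λ x → x % d ≟ a) (q * d)   ≤⟨ s≤s (count-%≡ q d a) ⟩
    suc q                                 ∎
    where
    open ≤-Reasoning
    residue-unique : ∀ {x y} → x < d → y < d → x % d ≡ a → y % d ≡ a → x ≡ y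
    residue-unique {x} {y} x<d y<d x≡a y≡a = begin-equality
      x     ≡⟨ m<n⇒m%n≡m x<d ⟨
      x % d ≡⟨ trans x≡a (sym y≡a) ⟩
      y % d ≡⟨ m<n⇒m%n≡m y<d ⟩
      y     ∎
    shift : ∀ {x} → (d + x) % d ≡ a → x % d ≡ a
    shift {x} = trans (trans (sym ([m+n]%n≡m%n x d)) (cong (_% d) (+-comm x d)))

  sum-mono : ∀ {m} {u v : Vector ℕ m} → (∀ i → u i ≤ v i) → sum u ≤ sum v
  sum-mono {zero}  _   = z≤n
  sum-mono {suc m} u≤v = +-mono-≤ (u≤v zero) (sum-mono (u≤v ∘ suc))

  sum-< : ∀ {m} {u v : Vector ℕ m} i → (∀ j → u j ≤ v j) → u i < v i → sum u < sum v
  sum-< zero    u≤v ui<vi = +-mono-<-≤ ui<vi (sum-mono (u≤v ∘ suc))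
  sum-< (suc i) u≤v ui<vi = +-mono-≤-< (u≤v zero) (sum-< i (u≤v ∘ suc) ui<vi)

  halves⇒+< : ∀ a b {n} → suc a * 2 ≤ n → suc b * 2 ≤ n → a + b < n
  halves⇒+< a b {n} a-half b-half = *-cancelʳ-≤ (suc (a + b)) n 2 (begin
    suc (a + b) * 2       ≤⟨ *-monoˡ-≤ 2 (s≤s (+-monoʳ-≤ a (n≤1+n b))) ⟩
    (suc a + suc b) * 2   ≡⟨ *-distribʳ-+ 2 (suc a) (suc b) ⟩
    suc a * 2 + suc b * 2 ≤⟨ +-mono-≤ a-half b-half ⟩
    n + n                 ≡⟨ cong (n +_) (+-identityʳ n) ⟨
    2 * n                 ≡⟨ *-comm 2 n ⟩
    n * 2                 ∎)
    where open ≤-Reasoning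

module Fractions where

  open import Data.Nat as ℕ using (ℕ; zero; suc; NonZero)
  import Data.Nat.Properties as ℕₚ
  open import Data.Integer as ℤ using (+_)
  import Data.Integer.Properties as ℤₚ
  open import Data.Rational using (ℚ; _/_; _≤_; _+_; toℚᵘ)
  open import Data.Rational.Properties
    using (toℚᵘ-mono-≤; toℚᵘ-cancel-≤; toℚᵘ-injective; toℚᵘ-homo-+; toℚᵘ-fromℚᵘ;
           ≤-refl; +-mono-≤; 0/n≡0)
  import Data.Rational.Unnormalised as ℚᵘ
  import Data.Rational.Unnormalised.Properties as ℚᵘₚ
  open import Data.Fin using (zero; suc)
  open import Data.Vec.Functional using (Vector)
  open import Algebra.Properties.Monoid.Sum ℕₚ.+-0-monoid using (sum)
  open import Relation.Binary.PropositionalEquality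
  open import Defs using (recip; sumFin)

  recip-/ : ∀ n .{{_ : NonZero n}} → recip n ≡ (+ 1) / n
  recip-/ (suc n) = refl

  toℚᵘ-/ : ∀ a d .{{_ : NonZero d}} → toℚᵘ ((+ a) / d) ℚᵘ.≃ (+ a) ℚᵘ./ d
  toℚᵘ-/ a (suc d) = toℚᵘ-fromℚᵘ (ℚᵘ.mkℚᵘ (+ a) d)

  /-≤-/⇒*-≤ : ∀ a b c d .{{_ : NonZero b}} .{{_ : NonZero d}} →
              (+ a) / b ≤ (+ c) / d → a ℕ.* d ℕ.≤ c ℕ.* b
  /-≤-/⇒*-≤ a b@(suc _) c d@(suc _) a/b≤c/d
    with ℚᵘ.*≤* ad≤cb ← ℚᵘₚ.≤-respʳ-≃ (toℚᵘ-/ c d)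
                          (ℚᵘₚ.≤-respˡ-≃ (toℚᵘ-/ a b) (toℚᵘ-mono-≤ a/b≤c/d))
    = ℤₚ.drop‿+≤+ (subst₂ ℤ._≤_ (sym (ℤₚ.pos-* a d)) (sym (ℤₚ.pos-* c b)) ad≤cb)

  *-≤⇒/-≤-/ : ∀ a b c d .{{_ : NonZero b}} .{{_ : NonZero d}} →
              a ℕ.* d ℕ.≤ c ℕ.* b → (+ a) / b ≤ (+ c) / d
  *-≤⇒/-≤-/ a b@(suc _) c d@(suc _) ad≤cb =
    toℚᵘ-cancel-≤ (ℚᵘₚ.≤-respʳ-≃ (ℚᵘₚ.≃-sym (toℚᵘ-/ c d))
      (ℚᵘₚ.≤-respˡ-≃ (ℚᵘₚ.≃-sym (toℚᵘ-/ a b))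
        (ℚᵘ.*≤* (subst₂ ℤ._≤_ (ℤₚ.pos-* a d) (ℤₚ.pos-* c b) (ℤ.+≤+ ad≤cb)))))

  /-+-/ : ∀ a c d .{{_ : NonZero d}} → (+ a) / d + (+ c) / d ≡ (+ (a ℕ.+ c)) / d
  /-+-/ a c d@(suc _) = toℚᵘ-injective sum≃
    where
    D = + d
    cross : ((+ a) ℤ.* D ℤ.+ (+ c) ℤ.* D) ℤ.* D ≡ (+ (a ℕ.+ c)) ℤ.* (D ℤ.* D)
    cross = begin
      ((+ a) ℤ.* D ℤ.+ (+ c) ℤ.* D) ℤ.* D ≡⟨ cong (ℤ._* D) (ℤₚ.*-distribʳ-+ D (+ a) (+ c)) ⟨
      ((+ a) ℤ.+ (+ c)) ℤ.* D ℤ.* D       ≡⟨ ℤₚ.*-assoc ((+ a) ℤ.+ (+ c)) D D ⟩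
      ((+ a) ℤ.+ (+ c)) ℤ.* (D ℤ.* D)     ≡⟨ cong (ℤ._* (D ℤ.* D)) (ℤₚ.pos-+ a c) ⟨
      (+ (a ℕ.+ c)) ℤ.* (D ℤ.* D)         ∎
      where open ≡-Reasoning
    sum≃ : toℚᵘ ((+ a) / d + (+ c) / d) ℚᵘ.≃ toℚᵘ ((+ (a ℕ.+ c)) / d)
    sum≃ = begin
      toℚᵘ ((+ a) / d + (+ c) / d)              ≈⟨ toℚᵘ-homo-+ ((+ a) / d) ((+ c) / d) ⟩
      toℚᵘ ((+ a) / d) ℚᵘ.+ toℚᵘ ((+ c) / d)    ≈⟨ ℚᵘₚ.+-cong (toℚᵘ-/ a d) (toℚᵘ-/ c d) ⟩
      (+ a) ℚᵘ./ d ℚᵘ.+ (+ c) ℚᵘ./ d            ≈⟨ ℚᵘ.*≡* cross ⟩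
      (+ (a ℕ.+ c)) ℚᵘ./ d                      ≈⟨ toℚᵘ-/ (a ℕ.+ c) d ⟨
      toℚᵘ ((+ (a ℕ.+ c)) / d)                  ∎
      where open import Relation.Binary.Reasoning.Setoid ℚᵘₚ.≃-setoid

  sumFin-/ : ∀ m (g : Vector ℕ m) d .{{_ : NonZero d}} → sumFin m (λ i → (+ g i) / d) ≡ (+ sum g) / d
  sumFin-/ zero    g d = sym (0/n≡0 d)
  sumFin-/ (suc m) g d = trans (cong (λ s → (+ g zero) / d + s) (sumFin-/ m (λ i → g (suc i)) d))
                               (/-+-/ (g zero) (sum (λ i → g (suc i))) d)

  sumFin-mono : ∀ m {g h : Vector ℚ m} → (∀ i → g i ≤ h i) → sumFin m g ≤ sumFin m h
  sumFin-mono zero    g≤h = ≤-refl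
  sumFin-mono (suc m) g≤h = +-mono-≤ (g≤h zero) (sumFin-mono m (λ i → g≤h (suc i)))

module Greedy where

  open import Data.Nat using (ℕ; _≤_)
  open import Data.Nat.Properties using (≤-trans; ≤-decTotalOrder)
  open import Data.Fin using (Fin; _≟_)
  open import Data.Product using (∃-syntax; _×_; _,_)
  open import Data.List using (List; []; _∷_; allFin)
  open import Data.List.Membership.Propositional using (_∈_)
  open import Data.List.Membership.Propositional.Properties using (∈-allFin)
  open import Data.List.Relation.Unary.All as All using (All)
  open import Data.List.Relation.Unary.Any as Any using ()
  open import Data.List.Relation.Unary.AllPairs using (AllPairs; []; _∷_)
  open import Data.List.Relation.Unary.Linked.Properties using (Linked⇒AllPairs)
  open import Data.List.Relation.Binary.Permutation.Propositional using (↭-sym)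
  open import Data.List.Relation.Binary.Permutation.Propositional.Properties using (∈-resp-↭)
  import Data.List.Sort as Sort
  import Relation.Binary.Construct.On as On
  import Relation.Binary.Construct.Flip.Ord as Flip
  open import Data.Vec.Functional using (updateAt)
  open import Data.Vec.Functional.Properties using (updateAt-updates; updateAt-minimal)
  open import Function using (const)
  open import Relation.Nullary using (yes; no; contradiction)
  open import Relation.Binary.PropositionalEquality using (_≡_; _≢_; refl; sym; subst)

  module _
    {n : ℕ} (rank : Fin n → ℕ)
    (Fits : Fin n → ℕ → Set)
    (Compatible : Fin n → ℕ → Fin n → ℕ → Set)
    (compatible-sym : ∀ {i r j s} → Compatible i r j s → Compatible j s i r)
    (choose : ∀ i (ρ : Fin n → ℕ) →
              ∃[ r ] Fits i r × (∀ j → j ≢ i → rank j ≤ rank i → Compatible i r j (ρ j)))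
    where

    Consistent : List (Fin n) → (Fin n → ℕ) → Set
    Consistent L ρ = (∀ {i} → i ∈ L → Fits i (ρ i)) ×
                     (∀ {i j} → i ∈ L → j ∈ L → i ≢ j → Compatible i (ρ i) j (ρ j))

    -- A list is placed from its end, so each head is placed after everything of smaller rank.
    consistent-along : ∀ L → AllPairs (λ i j → rank j ≤ rank i) L → ∃[ ρ ] Consistent L ρ
    consistent-along []      []                  = const 0 , (λ ()) , (λ ())
    consistent-along (i ∷ L) (i-tops-L ∷ sorted)
      with ρ , fits , compatible ← consistent-along L sorted
      with r , fits-r , compatible-r ← choose i ρ
      = ρ′ , fits′ , compatible′
      where
      ρ′ : Fin n → ℕ
      ρ′ = updateAt ρ i (const r)

      ρ′-i : ρ′ i ≡ r
      ρ′-i = updateAt-updates i ρ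

      ρ′-≢ : ∀ {j} → j ≢ i → ρ′ j ≡ ρ j
      ρ′-≢ j≢i = updateAt-minimal _ i ρ j≢i

      fits′ : ∀ {j} → j ∈ i ∷ L → Fits j (ρ′ j)
      fits′ {j} j∈ with j ≟ i
      ... | yes refl = subst (Fits i) (sym ρ′-i) fits-r
      ... | no j≢i   = subst (Fits j) (sym (ρ′-≢ j≢i)) (fits (Any.tail j≢i j∈))

      new-vs-old : ∀ {j} → j ∈ i ∷ L → j ≢ i → Compatible i (ρ′ i) j (ρ′ j)
      new-vs-old j∈ j≢i rewrite ρ′-i | ρ′-≢ j≢i =
        compatible-r _ j≢i (All.lookup i-tops-L (Any.tail j≢i j∈))

      compatible′ : ∀ {j j′} → j ∈ i ∷ L → j′ ∈ i ∷ L → j ≢ j′ → Compatible j (ρ′ j) j′ (ρ′ j′)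
      compatible′ {j} {j′} j∈ j′∈ j≢j′ with j ≟ i | j′ ≟ i
      ... | yes refl | yes refl = contradiction refl j≢j′
      ... | yes refl | no j′≢i  = new-vs-old j′∈ j′≢i
      ... | no j≢i   | yes refl = compatible-sym (new-vs-old j∈ j≢i)
      ... | no j≢i   | no j′≢i rewrite ρ′-≢ j≢i | ρ′-≢ j′≢i =
        compatible (Any.tail j≢i j∈) (Any.tail j′≢i j′∈) j≢j′

    open Sort (On.decTotalOrder (Flip.decTotalOrder ≤-decTotalOrder) rank) using (sort; sort-↭; sort-↗)

    byRank : List (Fin n)
    byRank = sort (allFin n)

    ∈-byRank : ∀ i → i ∈ byRank
    ∈-byRank i = ∈-resp-↭ (↭-sym (sort-↭ (allFin n))) (∈-allFin i)

    byRank-sorted : AllPairs (λ i j → rank j ≤ rank i) byRank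
    byRank-sorted = Linked⇒AllPairs (λ p q → ≤-trans q p) (sort-↗ (allFin n))

    assignment : ∃[ ρ ] (∀ i → Fits i (ρ i)) × (∀ i j → i ≢ j → Compatible i (ρ i) j (ρ j))
    assignment with ρ , fits , compatible ← consistent-along byRank byRank-sorted =
      ρ , (λ i → fits (∈-byRank i)) , (λ i j → compatible (∈-byRank i) (∈-byRank j))

module Residues where

  open import Data.Nat
  open import Data.Nat.Properties
  open import Data.Nat.DivMod using (_%_; m<n⇒m%n≡m; [m+n]%n≡m%n)
  open import Data.Product using (∃-syntax; _×_; _,_)
  open import Relation.Binary.PropositionalEquality

  residue-in-window : ∀ n .{{_ : NonZero n}} {r} t → r < n → ∃[ i ] i < n × (t + i) % n ≡ r
  residue-in-window n zero r<n = _ , r<n , m<n⇒m%n≡m r<n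
  residue-in-window n {r} (suc t) r<n with residue-in-window n t r<n
  ... | suc i , i<n , t+1+i≡r = i , <-trans (n<1+n i) i<n , trans (cong (_% n) (sym (+-suc t i))) t+1+i≡r
  ... | zero  , _   , t+0≡r  = pred n , ≤-reflexive (suc-pred n) , (begin
    (suc t + pred n) % n   ≡⟨ cong (_% n) (+-suc t (pred n)) ⟨
    (t + suc (pred n)) % n ≡⟨ cong (λ x → (t + x) % n) (suc-pred n) ⟩
    (t + n) % n            ≡⟨ [m+n]%n≡m%n t n ⟩
    t % n                  ≡⟨ cong (_% n) (+-identityʳ t) ⟨
    (t + 0) % n            ≡⟨ t+0≡r ⟩
    r                      ∎)
    where open ≡-Reasoning

module PowerOfTwoPeriods where

  open import Defs
  open Counting
  open Fractions
  open Residues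
  open import Data.Nat as ℕ using (ℕ; suc; _+_; _*_; _∸_; _^_; _<_; _≤_; _≤?_; NonZero; z≤n; z<s)
  open import Data.Nat.Properties
  open import Data.Nat.DivMod using (_%_; m∣n⇒o%n%m≡o%m)
  open import Data.Nat.Divisibility using (divides)
  open import Data.Bool using (true; false; if_then_else_)
  open import Data.Bool.Properties using (T-≡)
  import Data.Fin as Fin
  open import Data.Fin.Properties using (any?)
  open import Data.Product using (∃-syntax; _×_; _,_; proj₁; proj₂)
  open import Data.Sum using (_⊎_; inj₁; inj₂)
  open import Data.Empty using (⊥)
  open import Data.Integer using (+_)
  open import Data.Rational as ℚ using (0ℚ; _/_)
  import Data.Rational.Properties as ℚₚ
  open import Algebra.Properties.Monoid.Sum +-0-monoid using (sum)
  open import Function.Bundles using (Equivalence)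
  open import Level using (0ℓ)
  open import Relation.Unary using (Pred; Decidable)
  open import Relation.Unary.Properties using (_∪?_)
  open import Relation.Nullary using (Dec; yes; no; does; ¬_; ¬?; contradiction; _×-dec_; _⊎-dec_)
  open import Relation.Nullary.Decidable using (dec-true)
  open import Relation.Binary.PropositionalEquality

  module _ (G : Graph) (f : Edge G → ℕ) (pw : ∀ e → IsPowerOfTwo (f e)) where

    _∈ₑ_ : Vertex G → Edge G → Set
    _∈ₑ_ = _∈ᵉ_ {G}

    _∈ₑ?_ : ∀ w e → Dec (w ∈ₑ e)
    w ∈ₑ? e = (w Fin.≟ proj₁ (ends G e)) ⊎-dec (w Fin.≟ proj₂ (ends G e))

    incident?≡does : ∀ w e → incident? G w e ≡ does (w ∈ₑ? e)
    incident?≡does w e with does (w Fin.≟ proj₁ (ends G e)) | does (w Fin.≟ proj₂ (ends G e))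
    ... | false | false = refl
    ... | false | true  = refl
    ... | true  | _     = refl

    ∈ₑ⇒incident? : ∀ {w e} → w ∈ₑ e → incident? G w e ≡ true
    ∈ₑ⇒incident? {w} {e} w∈e = trans (incident?≡does w e) (dec-true (w ∈ₑ? e) w∈e)

    k : Edge G → ℕ
    k e = proj₁ (pw e)

    period : Edge G → ℕ
    period e = 2 ^ k e

    instance
      period-nonZero : ∀ {e} → NonZero (period e)
      period-nonZero {e} = m^n≢0 2 (k e)

    period-split : ∀ {e e′} → k e′ ≤ k e → period e ≡ 2 ^ (k e ∸ k e′) * period e′
    period-split {e} {e′} ke′≤ke = begin
      2 ^ k e                        ≡⟨ cong (2 ^_) (m∸n+n≡m ke′≤ke) ⟨
      2 ^ (k e ∸ k e′ + k e′)        ≡⟨ ^-distribˡ-+-* 2 (k e ∸ k e′) (k e′) ⟩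
      2 ^ (k e ∸ k e′) * period e′   ∎
      where open ≡-Reasoning

    recip-f≡1/period : ∀ e → recip (f e) ≡ (+ 1) / period e
    recip-f≡1/period e = trans (cong recip (proj₂ (pw e))) (recip-/ (period e))

    -- share e w e′ / period e is the term 1 / f e′ of load w if w ∈ e′ and f e′ ≤ f e (and 0
    -- otherwise); share e w e′ is also the number of residues modulo period e that e′ occupies.
    share : Edge G → Vertex G → Edge G → ℕ
    share e w e′ with incident? G w e′ | k e′ ≤? k e
    ... | true  | yes _ = 2 ^ (k e ∸ k e′)
    ... | true  | no _  = 0
    ... | false | _     = 0

    scaledLoad : Edge G → Vertex G → ℕ
    scaledLoad e w = sum (share e w)

    share-≡ : ∀ {e w e′} → w ∈ₑ e′ → k e′ ≤ k e → share e w e′ ≡ 2 ^ (k e ∸ k e′)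
    share-≡ {e} {w} {e′} w∈e′ ke′≤ke rewrite ∈ₑ⇒incident? w∈e′ with k e′ ≤? k e
    ... | yes _     = refl
    ... | no ke′≰ke = contradiction ke′≤ke ke′≰ke

    share/period≤load-term : ∀ e w e′ →
      (+ share e w e′) / period e ℚ.≤ (if incident? G w e′ then recip (f e′) else 0ℚ)
    share/period≤load-term e w e′ with incident? G w e′ | k e′ ≤? k e
    ... | true  | yes ke′≤ke =
      subst ((+ 2 ^ (k e ∸ k e′)) / period e ℚ.≤_) (sym (recip-f≡1/period e′))
        (*-≤⇒/-≤-/ (2 ^ (k e ∸ k e′)) (period e) 1 (period e′)
          (≤-reflexive (trans (sym (period-split ke′≤ke)) (sym (*-identityˡ (period e))))))
    ... | true  | no _ =
      subst ((+ 0) / period e ℚ.≤_) (sym (recip-f≡1/period e′)) (*-≤⇒/-≤-/ 0 (period e) 1 (period e′) z≤n)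
    ... | false | _ = ℚₚ.≤-reflexive (ℚₚ.0/n≡0 (period e))

    scaledLoad-bound : (∀ v → load G f v ℚ.≤ (+ 1) / 2) → ∀ e w → scaledLoad e w * 2 ≤ period e
    scaledLoad-bound half-loaded e w =
      ≤-trans (/-≤-/⇒*-≤ (scaledLoad e w) (period e) 1 2 scaledLoad/period≤½)
              (≤-reflexive (*-identityˡ (period e)))
      where
      open ℚₚ.≤-Reasoning
      scaledLoad/period≤½ : (+ scaledLoad e w) / period e ℚ.≤ (+ 1) / 2
      scaledLoad/period≤½ = begin
        (+ scaledLoad e w) / period e                     ≡⟨ sumFin-/ (m G) (share e w) (period e) ⟨
        sumFin (m G) (λ e′ → (+ share e w e′) / period e) ≤⟨ sumFin-mono (m G) (share/period≤load-term e w) ⟩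
        load G f w                                        ≤⟨ half-loaded w ⟩
        (+ 1) / 2                                         ∎

    Adjacent : Edge G → Edge G → Set
    Adjacent e e′ = ∃[ w ] w ∈ₑ e × w ∈ₑ e′

    Compatible : Edge G → ℕ → Edge G → ℕ → Set
    Compatible e r e′ r′ = Adjacent e e′ → ∀ t → t % period e ≡ r → t % period e′ ≡ r′ → ⊥

    compatible-sym : ∀ {e r e′ r′} → Compatible e r e′ r′ → Compatible e′ r′ e r
    compatible-sym apart (w , w∈e′ , w∈e) t t≡r′ t≡r = apart (w , w∈e , w∈e′) t t≡r t≡r′

    module Choice (scaledLoad-half : ∀ e w → scaledLoad e w * 2 ≤ period e)
                  (ρ : Edge G → ℕ) (e : Edge G) where

      Clash : Vertex G → Edge G → Pred ℕ 0ℓ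
      Clash w e′ r = e′ ≢ e × w ∈ₑ e′ × k e′ ≤ k e × r % period e′ ≡ ρ e′

      clash? : ∀ w e′ → Decidable (Clash w e′)
      clash? w e′ r = ¬? (e′ Fin.≟ e) ×-dec w ∈ₑ? e′ ×-dec k e′ ≤? k e ×-dec r % period e′ ℕ.≟ ρ e′

      BlockedAt : Vertex G → Pred ℕ 0ℓ
      BlockedAt w r = ∃[ e′ ] Clash w e′ r

      blockedAt? : ∀ w → Decidable (BlockedAt w)
      blockedAt? w r = any? (λ e′ → clash? w e′ r)

      count-clash≤ : ∀ w e′ → k e′ ≤ k e → count (clash? w e′) (period e) ≤ 2 ^ (k e ∸ k e′)
      count-clash≤ w e′ ke′≤ke = begin
        count (clash? w e′) (period e)          ≡⟨ cong (count (clash? w e′)) (period-split ke′≤ke) ⟩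
        count (clash? w e′) (q * period e′)     ≤⟨ count-mono (λ (_ , _ , _ , r≡ρ) → r≡ρ) (q * period e′) ⟩
        count (λ r → r % period e′ ℕ.≟ ρ e′) (q * period e′)
                                                ≤⟨ count-%≡ q (period e′) (ρ e′) ⟩
        q                                       ∎
        where
        open ≤-Reasoning
        q = 2 ^ (k e ∸ k e′)

      count-clash≤share : ∀ w e′ → count (clash? w e′) (period e) ≤ share e w e′
      count-clash≤share w e′ = by-cases (w ∈ₑ? e′) (k e′ ≤? k e)
        where
        none : (∀ {r} → ¬ Clash w e′ r) → count (clash? w e′) (period e) ≤ share e w e′
        none no-clash = ≤-trans (≤-reflexive (count-none (period e) λ _ → no-clash)) z≤n
        by-cases : Dec (w ∈ₑ e′) → Dec (k e′ ≤ k e) → count (clash? w e′) (period e) ≤ share e w e′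
        by-cases (yes w∈e′) (yes ke′≤ke) =
          ≤-trans (count-clash≤ w e′ ke′≤ke) (≤-reflexive (sym (share-≡ w∈e′ ke′≤ke)))
        by-cases (no w∉e′) _           = none λ (_ , w∈e′ , _) → w∉e′ w∈e′
        by-cases _         (no ke′≰ke) = none λ (_ , _ , ke′≤ke , _) → ke′≰ke ke′≤ke

      count-blockedAt< : ∀ {w} → w ∈ₑ e → count (blockedAt? w) (period e) < scaledLoad e w
      count-blockedAt< {w} w∈e = begin-strict
        count (blockedAt? w) (period e)               ≤⟨ count-∃ (clash? w) (period e) ⟩
        sum (λ e′ → count (clash? w e′) (period e))   <⟨ sum-< e (count-clash≤share w) no-clash-with-e ⟩
        scaledLoad e w                                ∎
        where
        open ≤-Reasoning
        no-clash-with-e : count (clash? w e) (period e) < share e w e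
        no-clash-with-e = subst₂ _<_ (sym (count-none (period e) λ _ (e≢e , _) → e≢e refl))
                                     (sym (trans (share-≡ w∈e ≤-refl) (cong (2 ^_) (n∸n≡0 (k e)))))
                                     z<s

      u v : Vertex G
      u = proj₁ (ends G e)
      v = proj₂ (ends G e)

      count-blocked< : count (blockedAt? u ∪? blockedAt? v) (period e) < period e
      count-blocked< = ≤-<-trans (count-∪ (period e))
                         (halves⇒+< (blocked-by u) (blocked-by v) (half-bound (inj₁ refl)) (half-bound (inj₂ refl)))
        where
        blocked-by : Vertex G → ℕ
        blocked-by w = count (blockedAt? w) (period e)
        half-bound : ∀ {w} → w ∈ₑ e → suc (blocked-by w) * 2 ≤ period e
        half-bound {w} w∈e = ≤-trans (*-monoˡ-≤ 2 (count-blockedAt< w∈e)) (scaledLoad-half e w)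

      choose : ∃[ r ] r < period e × (∀ e′ → e′ ≢ e → k e′ ≤ k e → Compatible e r e′ (ρ e′))
      choose with r , r<period , r-free ← count<⇒∃∉ (period e) count-blocked< = r , r<period , compatible
        where
        compatible : ∀ e′ → e′ ≢ e → k e′ ≤ k e → Compatible e r e′ (ρ e′)
        compatible e′ e′≢e ke′≤ke (w , w∈e , w∈e′) t t≡r t≡ρ =
          r-free (blocked w∈e (e′ , e′≢e , w∈e′ , ke′≤ke , r≡ρ))
          where
          r≡ρ : r % period e′ ≡ ρ e′
          r≡ρ = begin
            r % period e′              ≡⟨ cong (_% period e′) t≡r ⟨
            t % period e % period e′   ≡⟨ m∣n⇒o%n%m≡o%m (period e′) (period e) t
                                            (divides (2 ^ (k e ∸ k e′)) (period-split ke′≤ke)) ⟩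
            t % period e′              ≡⟨ t≡ρ ⟩
            ρ e′                       ∎
            where open ≡-Reasoning
          blocked : ∀ {w} → w ∈ₑ e → BlockedAt w r → BlockedAt u r ⊎ BlockedAt v r
          blocked (inj₁ refl) = inj₁
          blocked (inj₂ refl) = inj₂

    schedule : (∀ e w → scaledLoad e w * 2 ≤ period e) → ∃[ S ] Valid G f S
    schedule scaledLoad-half
      with ρ , fits , compatible ← Greedy.assignment k (λ e r → r < period e) Compatible compatible-sym
                                     (λ e ρ → Choice.choose scaledLoad-half ρ e)
      = S , matching , recurrent
      where
      S : Schedule G
      S t e = t % period e ℕ.≡ᵇ ρ e

      scheduled : ∀ {t e} → S t e ≡ true → t % period e ≡ ρ e
      scheduled {t} {e} St = ≡ᵇ⇒≡ (t % period e) (ρ e) (Equivalence.from T-≡ St)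

      matching : ∀ t → IsMatching G (S t)
      matching t e e′ Ste Ste′ e≢e′ w w∈e w∈e′ =
        compatible e e′ e≢e′ (w , w∈e , w∈e′) t (scheduled Ste) (scheduled Ste′)

      recurrent : ∀ e t → ∃[ i ] i < f e × S (t + i) e ≡ true
      recurrent e t with i , i<period , t+i≡ρ ← residue-in-window (period e) t (fits e) =
        i , subst (i <_) (sym (proj₂ (pw e))) i<period ,
        Equivalence.to T-≡ (≡⇒≡ᵇ ((t + i) % period e) (ρ e) t+i≡ρ)

open import Defs
open import Data.Nat using (ℕ)
open import Data.Product using (∃-syntax)
open import Data.Integer using (+_)
open import Data.Rational using (_≤_; _/_)

theorem10 : (G : Graph) (f : Edge G → ℕ) →
            (∀ e → IsPowerOfTwo (f e)) →
            (∀ v → load G f v ≤ (+ 1) / 2) →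
            ∃[ S ] Valid G f S
theorem10 G f pw half-loaded = schedule G f pw (scaledLoad-bound G f pw half-loaded)
  where open PowerOfTwoPeriods
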